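{- Let $A,B$ be moulds in $\mathrm{ARI}$ (i.e. bimoulds depending only on the variables $u_i$, with $A(\emptyset)=B(\emptyset)=0$) which are $push$-invariant: $push(A)=A$, $push(B)=B$. Then $swap\big(ari(swap(A),swap(B))\big)=ari(A,B)$.
   Context: A bimould $M$ is a family $(M_r)_{r\ge0}$, $M_r$ a function of $u_1,\dots,u_r,v_1,\dots,v_r$, written $M(w_1,\dots,w_r)$ with $w_i=\binom{u_i}{v_i}$; $M(\emptyset)$ is a constant. A mould is a bimould depending only on the $u_i$; $\mathrm{ARI}$ is the set of moulds with $M(\emptyset)=0$. $mu(A,B)(w_1,\dots,w_r)=\sum_{i=0}^rA(w_1,\dots,w_i)B(w_{i+1},\dots,w_r)$, $limu(A,B)=mu(A,B)-mu(B,A)$. Flexions, for ${\bf w}={\bf a}{\bf b}{\bf c}$ with ${\bf a}=(w_1..w_k)$, ${\bf b}=(w_{k+1}..w_{k+l})$, ${\bf c}=(w_{k+l+1}..w_r)$: if ${\bf b},{\bf c}\ne\emptyset$, ${\bf a}\lceil{\bf c}=\binom{u_1,\dots,u_k,u_{k+1}+\dots+u_{k+l+1},u_{k+l+2},\dots,u_r}{v_1,\dots,v_k,v_{k+l+1},\dots,v_r}$, ${\bf b}\rfloor=\binom{u_{k+1},\dots,u_{k+l}}{v_{k+1}-v_{k+l+1},\dots,v_{k+l}-v_{k+l+1}}$; if ${\bf a},{\bf b}\ne\emptyset$, ${\bf a}\rceil{\bf c}=\binom{u_1,\dots,u_{k-1},u_k+\dots+u_{k+l},u_{k+l+1},\dots,u_r}{v_1,\dots,v_k,v_{k+l+1},\dots,v_r}$,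 $\lfloor{\bf b}=\binom{u_{k+1},\dots,u_{k+l}}{v_{k+1}-v_k,\dots,v_{k+l}-v_k}$. $(arit(B)A)({\bf w})=\sum_{{\bf w}={\bf a}{\bf b}{\bf c},\,{\bf b},{\bf c}\ne\emptyset}A({\bf a}\lceil{\bf c})B({\bf b}\rfloor)-\sum_{{\bf w}={\bf a}{\bf b}{\bf c},\,{\bf a},{\bf b}\ne\emptyset}A({\bf a}\rceil{\bf c})B(\lfloor{\bf b})$, and $ari(A,B)=arit(B)A-arit(A)B+limu(A,B)$ (defined for all bimoulds with zero constant term). $swap(M)\binom{u_1,\dots,u_r}{v_1,\dots,v_r}=M\binom{v_r,\ v_{r-1}-v_r,\ \dots,\ v_1-v_2}{u_1+\dots+u_r,\ u_1+\dots+u_{r-1},\ \dots,\ u_1}$; $push(M)\binom{u_1,\dots,u_r}{v_1,\dots,v_r}=M\binom{ -u_1-\dots-u_r,\ u_1,\dots,u_{r-1}}{ -v_r,\ v_1-v_r,\dots,v_{r-1}-v_r}$ (both act trivially in depth 0). -}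

module Defs where

open import Level using (Level; _⊔_)
open import Algebra.Bundles using (CommutativeRing)
open import Data.Product using (_×_; _,_; proj₁; proj₂)
open import Data.List using (List; []; _∷_; _++_; map; reverse; zip; concatMap)
open import Data.List.Relation.Binary.Pointwise using (Pointwise)
open import Relation.Binary.PropositionalEquality using (_≡_)

module _ {c ℓ : Level} (R : CommutativeRing c ℓ) where
  open CommutativeRing R renaming (Carrier to K)

  -- a sequence w = (w_1,...,w_r), w_i = (u_i , v_i)
  Word : Set c
  Word = List (K × K)

  -- a bimould: the family (M_r)_r, M_r applied to words of length r
  Bimould : Set c
  Bimould = Word → K

  Congruent : Bimould → Set (c ⊔ ℓ)
  Congruent M = ∀ w w' →
    Pointwise (λ p q → (proj₁ p ≈ proj₁ q) × (proj₂ p ≈ proj₂ q)) w w' →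
    M w ≈ M w'

  IsMould : Bimould → Set (c ⊔ ℓ)
  IsMould M = ∀ w w' → map proj₁ w ≡ map proj₁ w' → M w ≈ M w'

  InARI : Bimould → Set (c ⊔ ℓ)
  InARI M = IsMould M × (M [] ≈ 0#)

  sumK : List K → K
  sumK [] = 0#
  sumK (x ∷ xs) = x + sumK xs

  sumU : Word → K
  sumU w = sumK (map proj₁ w)

  splits : Word → List (Word × Word)
  splits [] = ([] , []) ∷ []
  splits (x ∷ w) = ([] , x ∷ w) ∷ map (λ p → (x ∷ proj₁ p , proj₂ p)) (splits w)

  splits3 : Word → List (Word × Word × Word)
  splits3 w = concatMap (λ p → map (λ q → (proj₁ p , proj₁ q , proj₂ q)) (splits (proj₂ p))) (splits w)

  data LastView : Word → Set c where
    empty : LastView []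
    snoc  : (a' : Word) (x : K × K) → LastView (a' ++ (x ∷ []))

  lastView : (w : Word) → LastView w
  lastView [] = empty
  lastView (x ∷ w) with lastView w
  ... | empty = snoc [] x
  ... | snoc a' y = snoc (x ∷ a') y

  shiftV : K → Word → Word
  shiftV t = map (λ p → (proj₁ p , proj₂ p - t))

  mu : Bimould → Bimould → Bimould
  mu A B w = sumK (map (λ p → A (proj₁ p) * B (proj₂ p)) (splits w))

  limu : Bimould → Bimould → Bimould
  limu A B w = mu A B w - mu B A w

  -- term  A(a⌈c) B(b⌋)  (zero unless b, c nonempty)
  upperTerm : Bimould → Bimould → Word → Word → Word → K
  upperTerm A B a [] c = 0#
  upperTerm A B a (b₁ ∷ b) [] = 0#
  upperTerm A B a (b₁ ∷ b) ((u , v) ∷ c) =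
    A (a ++ ((sumU (b₁ ∷ b) + u , v) ∷ c)) * B (shiftV v (b₁ ∷ b))

  -- term  A(a⌉c) B(⌊b)  (zero unless a, b nonempty)
  lowerTerm : Bimould → Bimould → Word → Word → Word → K
  lowerTerm A B a [] c = 0#
  lowerTerm A B a (b₁ ∷ b) c with lastView a
  ... | empty = 0#
  ... | snoc a' (u , v) =
    A (a' ++ ((u + sumU (b₁ ∷ b) , v) ∷ c)) * B (shiftV v (b₁ ∷ b))

  arit : Bimould → Bimould → Bimould
  arit B A w =
    sumK (map (λ t → upperTerm A B (proj₁ t) (proj₁ (proj₂ t)) (proj₂ (proj₂ t))) (splits3 w))
    - sumK (map (λ t → lowerTerm A B (proj₁ t) (proj₁ (proj₂ t)) (proj₂ (proj₂ t))) (splits3 w))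

  ari : Bimould → Bimould → Bimould
  ari A B w = arit B A w - arit A B w + limu A B w

  diffs : List K → List K
  diffs [] = []
  diffs (x ∷ []) = x ∷ []
  diffs (x ∷ y ∷ xs) = (x - y) ∷ diffs (y ∷ xs)

  psums : List K → List K
  psums [] = []
  psums (x ∷ xs) = x ∷ map (x +_) (psums xs)

  -- swap(M)(u;v) = M(v_r, v_{r-1}-v_r, ..., v_1-v_2 ; u_1+..+u_r, ..., u_1)
  swap : Bimould → Bimould
  swap M w = M (zip (reverse (diffs (map proj₂ w))) (reverse (psums (map proj₁ w))))

  -- push(M)(u;v) = M(-u_1-..-u_r, u_1, .., u_{r-1} ; -v_r, v_1-v_r, .., v_{r-1}-v_r)
  pushAux : (w : Word) → LastView w → Bimould → K
  pushAux .[] empty M = M []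
  pushAux .(a' ++ ((u , v) ∷ [])) (snoc a' (u , v)) M =
    M ((- sumU (a' ++ ((u , v) ∷ [])) , - v) ∷ shiftV v a')

  push : Bimould → Bimould
  push M w = pushAux w (lastView w) M

module Submission where

-- Let A, B be push-invariant moulds in ARI, and write α, β for A, B seen as
-- functions of the list of upper variables only.  Evaluating
-- swap(ari(swap A, swap B)) at a word w means evaluating ari(swap A, swap B)
-- at the "swap point" w*, whose lower row is the reversed list of partial sums
-- of the upper row x = (u₁,…,u_r) of w; there swap A and swap B are α and β
-- applied to reversed successive differences.  Every ingredient of ari is a
-- sum over the decompositions of a word into two or three factors, and the
-- decompositions of w* correspond, in reverse order, to those of x.
-- Re-indexing term by term gives, with D = Σ_{x = bc} A(b⌈c) B(b⌋)
-- (the upper terms of arit(B)A whose first factor is empty):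
--   upper part of arit(swap B)(swap A)(w*) = upper part of arit(B)A(w) − D + mu(A,B)(w),
--   lower part of arit(swap B)(swap A)(w*) = lower part of arit(B)A(w)   (uses push B = B),
--   mu(swap A, swap B)(w*)                 = D,
-- and the same with A and B exchanged; the D's and the mu's then cancel in
-- the combination ari = arit(B)A − arit(A)B + limu(A,B).

open import Defs
open import Level using (Level)
open import Algebra.Bundles using (CommutativeRing)
open import Algebra.Solver.Ring.AlmostCommutativeRing using (AlmostCommutativeRing; fromCommutativeRing; -raw-almostCommutative⟶)
open import Data.Product using (_×_; _,_; proj₁; proj₂)
open import Data.List using (List; []; _∷_; _++_; map; reverse; zip; concatMap; length)
open import Data.List.Properties using (map-∘; map-++; ++-assoc; reverse-involutive; ++-identityʳ; unfold-reverse; reverse-++; reverse-map; length-reverse; length-map)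
open import Data.List.Relation.Binary.Pointwise as PW using (Pointwise; []; _∷_)
open import Data.Maybe using (nothing)
open import Data.Nat using (suc)
open import Data.Nat.Properties using (suc-injective)
open import Relation.Binary.Bundles using (Setoid)
open import Relation.Binary.PropositionalEquality as P using (_≡_)

module Proof {c ℓ : Level} (R : CommutativeRing c ℓ) where
  open CommutativeRing R renaming (Carrier to K)
  open import Relation.Binary.Reasoning.Setoid setoid
  open import Algebra.Properties.AbelianGroup +-abelianGroup using (⁻¹-∙-comm; ⁻¹-involutive)
  open import Algebra.Properties.CommutativeSemigroup +-commutativeSemigroup using (interchange)
  import Algebra.Solver.Ring as RingSolver
  open RingSolver (AlmostCommutativeRing.rawRing (fromCommutativeRing R)) (fromCommutativeRing R)
                  (-raw-almostCommutative⟶ _) (λ _ _ → nothing)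

  -- Elementary ring identities.  The solver runs without a zero test, so
  -- identities needing cancellation x - x = 0 are finished by hand.

  neg-+ : ∀ x y → - (x + y) ≈ - x + - y
  neg-+ x y = sym (⁻¹-∙-comm x y)

  neg-- : ∀ x y → - (x - y) ≈ - x + y
  neg-- x y = trans (neg-+ x (- y)) (+-cong refl (⁻¹-involutive y))

  x-0≈x : ∀ x → x - 0# ≈ x
  x-0≈x x = trans (+-cong refl (trans (sym (+-identityˡ (- 0#))) (-‿inverseʳ 0#))) (+-identityʳ x)

  +-sub : ∀ k x p → (k + x) - p ≈ (k - p) + x
  +-sub = solve 3 (λ k x p → (k :+ x) :- p := (k :- p) :+ x) refl

  +-sub-self : ∀ k x → (k + x) - k ≈ x
  +-sub-self k x = trans (solve 2 (λ k x → (k :+ x) :- k := x :+ (k :- k)) refl k x)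
                         (trans (+-cong refl (-‿inverseʳ k)) (+-identityʳ x))

  0≈0-0+0 : 0# ≈ (0# - 0#) + 0#
  0≈0-0+0 = sym (trans (+-identityʳ _) (-‿inverseʳ 0#))

  cancel-lower : ∀ x y z w → ((x - ((x + (y + z)) + w)) - 0#) + y ≈ - (z + w)
  cancel-lower x y z w = begin
      ((x - ((x + (y + z)) + w)) - 0#) + y
    ≈⟨ +-cong (+-cong (+-cong refl (trans (neg-+ _ _) (+-cong (trans (neg-+ _ _) (+-cong refl (neg-+ _ _))) refl))) refl) refl ⟩
      ((x + ((- x + (- y + - z)) + - w)) + - 0#) + y
    ≈⟨ regroup x (- x) (- y) (- z) (- w) (- 0#) y ⟩
      ((x - x) + (y - y)) + ((- z + - w) - 0#)
    ≈⟨ +-cong (trans (+-cong (-‿inverseʳ x) (-‿inverseʳ y)) (+-identityˡ 0#)) (x-0≈x _) ⟩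
      0# + (- z + - w)
    ≈⟨ trans (+-identityˡ _) (sym (neg-+ z w)) ⟩
      - (z + w) ∎
    where
    regroup : ∀ x nx ny nz nw n0 y → ((x + ((nx + (ny + nz)) + nw)) + n0) + y ≈ ((x + nx) + (y + ny)) + ((nz + nw) + n0)
    regroup = solve 7 (λ x nx ny nz nw n0 y →
      ((x :+ ((nx :+ (ny :+ nz)) :+ nw)) :+ n0) :+ y := ((x :+ nx) :+ (y :+ ny)) :+ ((nz :+ nw) :+ n0)) refl

  -- the final cancellation of the D and mu contributions in the theorem
  rearrange : ∀ U L U′ L′ D D′ M M′ →
    ((((U - D) + M) - L) - (((U′ - D′) + M′) - L′)) + (D - D′) ≈ ((U - L) - (U′ - L′)) + (M - M′)
  rearrange U L U′ L′ D D′ M M′ = begin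
      ((((U - D) + M) - L) - (((U′ - D′) + M′) - L′)) + (D - D′)
    ≈⟨ +-cong (+-cong refl (trans (neg-- _ _) (+-cong (trans (neg-+ _ _) (+-cong (neg-- _ _) refl)) refl))) refl ⟩
      ((((U - D) + M) - L) + (((- U′ + D′) + - M′) + L′)) + (D - D′)
    ≈⟨ regroup U (- D) M (- L) (- U′) D′ (- M′) L′ D (- D′) ⟩
      (((U - L) + (- U′ + L′)) + (M - M′)) + ((D - D) + (D′ - D′))
    ≈⟨ +-cong (+-cong (+-cong refl (sym (neg-- _ _))) refl) (trans (+-cong (-‿inverseʳ D) (-‿inverseʳ D′)) (+-identityʳ 0#)) ⟩
      (((U - L) - (U′ - L′)) + (M - M′)) + 0#
    ≈⟨ +-identityʳ _ ⟩
      ((U - L) - (U′ - L′)) + (M - M′) ∎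
    where
    regroup : ∀ U nD M nL nU′ D′ nM′ L′ D nD′ →
      ((((U + nD) + M) + nL) + (((nU′ + D′) + nM′) + L′)) + (D + nD′) ≈ (((U + nL) + (nU′ + L′)) + (M + nM′)) + ((D + nD) + (D′ + nD′))
    regroup = solve 10 (λ U nD M nL nU′ D′ nM′ L′ D nD′ →
      ((((U :+ nD) :+ M) :+ nL) :+ (((nU′ :+ D′) :+ nM′) :+ L′)) :+ (D :+ nD′)
        := (((U :+ nL) :+ (nU′ :+ L′)) :+ (M :+ nM′)) :+ ((D :+ nD) :+ (D′ :+ nD′))) refl

  sumOver : ∀ {a} {X : Set a} → (X → K) → List X → K
  sumOver F l = sumK R (map F l)

  module _ {a} {X : Set a} where

    sumOver-cong : ∀ {F G : X → K} → (∀ x → F x ≈ G x) → ∀ l → sumOver F l ≈ sumOver G l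
    sumOver-cong h [] = refl
    sumOver-cong h (x ∷ l) = +-cong (h x) (sumOver-cong h l)

    sumOver-zero : ∀ {F : X → K} → (∀ x → F x ≈ 0#) → ∀ l → sumOver F l ≈ 0#
    sumOver-zero h [] = refl
    sumOver-zero h (x ∷ l) = trans (+-cong (h x) (sumOver-zero h l)) (+-identityˡ 0#)

    sumOver-+ : ∀ (F G : X → K) l → sumOver (λ x → F x + G x) l ≈ sumOver F l + sumOver G l
    sumOver-+ F G [] = sym (+-identityˡ 0#)
    sumOver-+ F G (x ∷ l) = trans (+-cong refl (sumOver-+ F G l)) (interchange _ _ _ _)

    sumOver-lin : ∀ (F G H : X → K) l →
      sumOver (λ x → (F x - G x) + H x) l ≈ (sumOver F l - sumOver G l) + sumOver H l
    sumOver-lin F G H [] = 0≈0-0+0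
    sumOver-lin F G H (x ∷ l) = trans (+-cong refl (sumOver-lin F G H l)) (regroup _ _ _ _ _ _)
      where
      regroup : ∀ a b c d e f → ((a - b) + c) + ((d - e) + f) ≈ ((a + d) - (b + e)) + (c + f)
      regroup = solve 6 (λ a b c d e f →
        ((a :- b) :+ c) :+ ((d :- e) :+ f) := ((a :+ d) :- (b :+ e)) :+ (c :+ f)) refl

    sumOver-++ : ∀ (F : X → K) xs ys → sumOver F (xs ++ ys) ≈ sumOver F xs + sumOver F ys
    sumOver-++ F [] ys = sym (+-identityˡ _)
    sumOver-++ F (x ∷ xs) ys = trans (+-cong refl (sumOver-++ F xs ys)) (sym (+-assoc _ _ _))

  sumOver-map : ∀ {a b} {X : Set a} {Y : Set b} (F : Y → K) (g : X → Y) l →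
    sumOver F (map g l) ≡ sumOver (λ x → F (g x)) l
  sumOver-map F g [] = P.refl
  sumOver-map F g (x ∷ l) = P.cong (F (g x) +_) (sumOver-map F g l)

  sumOver-concatMap : ∀ {a b} {X : Set a} {Y : Set b} (F : Y → K) (g : X → List Y) l →
    sumOver F (concatMap g l) ≈ sumOver (λ x → sumOver F (g x)) l
  sumOver-concatMap F g [] = refl
  sumOver-concatMap F g (x ∷ l) = trans (sumOver-++ F (g x) (concatMap g l)) (+-cong refl (sumOver-concatMap F g l))

  cuts : ∀ {a} {X : Set a} → List X → List (List X × List X)
  cuts [] = ([] , []) ∷ []
  cuts (x ∷ l) = ([] , x ∷ l) ∷ map (λ p → (x ∷ proj₁ p , proj₂ p)) (cuts l)

  Σ₂ : ∀ {a} {X : Set a} → (List X → List X → K) → List X → K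
  Σ₂ G l = sumOver (λ p → G (proj₁ p) (proj₂ p)) (cuts l)

  Σ₃ : ∀ {a} {X : Set a} → (List X → List X → List X → K) → List X → K
  Σ₃ F l = Σ₂ (λ a r → Σ₂ (F a) r) l

  splits≡cuts : ∀ w → splits R w ≡ cuts w
  splits≡cuts [] = P.refl
  splits≡cuts (x ∷ w) = P.cong (λ z → ([] , x ∷ w) ∷ map (λ p → (x ∷ proj₁ p , proj₂ p)) z) (splits≡cuts w)

  mu≡Σ₂ : ∀ (F G : Bimould R) w → mu R F G w ≡ Σ₂ (λ a c → F a * G c) w
  mu≡Σ₂ F G w = P.cong (sumOver (λ p → F (proj₁ p) * G (proj₂ p))) (splits≡cuts w)

  upperSum lowerSum : Bimould R → Bimould R → Word R → K
  upperSum A B w = sumK R (map (λ t → upperTerm R A B (proj₁ t) (proj₁ (proj₂ t)) (proj₂ (proj₂ t))) (splits3 R w))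
  lowerSum A B w = sumK R (map (λ t → lowerTerm R A B (proj₁ t) (proj₁ (proj₂ t)) (proj₂ (proj₂ t))) (splits3 R w))

  splits3≈Σ₃ : ∀ (F : Word R → Word R → Word R → K) w →
    sumK R (map (λ t → F (proj₁ t) (proj₁ (proj₂ t)) (proj₂ (proj₂ t))) (splits3 R w)) ≈ Σ₃ F w
  splits3≈Σ₃ F w = begin
      sumOver F′ (concatMap g (splits R w))
    ≈⟨ sumOver-concatMap F′ g (splits R w) ⟩
      sumOver (λ p → sumOver F′ (g p)) (splits R w)
    ≡⟨ P.cong (sumOver (λ p → sumOver F′ (g p))) (splits≡cuts w) ⟩
      sumOver (λ p → sumOver F′ (g p)) (cuts w)
    ≈⟨ sumOver-cong (λ p → reflexive (inner p)) (cuts w) ⟩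
      Σ₃ F w ∎
    where
    F′ : Word R × Word R × Word R → K
    F′ t = F (proj₁ t) (proj₁ (proj₂ t)) (proj₂ (proj₂ t))
    g : Word R × Word R → List (Word R × Word R × Word R)
    g p = map (λ q → (proj₁ p , proj₁ q , proj₂ q)) (splits R (proj₂ p))
    inner : ∀ p → sumOver F′ (g p) ≡ Σ₂ (F (proj₁ p)) (proj₂ p)
    inner p = P.trans (sumOver-map F′ (λ q → (proj₁ p , proj₁ q , proj₂ q)) (splits R (proj₂ p)))
                      (P.cong (sumOver (λ q → F (proj₁ p) (proj₁ q) (proj₂ q))) (splits≡cuts (proj₂ p)))

  module _ {a} {X : Set a} where

    Σ₂-cons : ∀ (G : List X → List X → K) x l → Σ₂ G (x ∷ l) ≡ G [] (x ∷ l) + Σ₂ (λ b c → G (x ∷ b) c) l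
    Σ₂-cons G x l = P.cong (G [] (x ∷ l) +_) (sumOver-map (λ p → G (proj₁ p) (proj₂ p)) (λ p → (x ∷ proj₁ p , proj₂ p)) (cuts l))

    Σ₂-cong : ∀ {G H : List X → List X → K} → (∀ b c → G b c ≈ H b c) → ∀ l → Σ₂ G l ≈ Σ₂ H l
    Σ₂-cong h l = sumOver-cong (λ p → h (proj₁ p) (proj₂ p)) (cuts l)

    Σ₃-cong : ∀ {F G : List X → List X → List X → K} → (∀ a b c → F a b c ≈ G a b c) → ∀ l → Σ₃ F l ≈ Σ₃ G l
    Σ₃-cong h l = Σ₂-cong (λ a r → Σ₂-cong (h a) r) l

    Σ₂-+ : ∀ (G H : List X → List X → K) l → Σ₂ (λ b c → G b c + H b c) l ≈ Σ₂ G l + Σ₂ H l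
    Σ₂-+ G H l = sumOver-+ (λ p → G (proj₁ p) (proj₂ p)) (λ p → H (proj₁ p) (proj₂ p)) (cuts l)

    Σ₃-lin : ∀ (F G H : List X → List X → List X → K) l →
      Σ₃ (λ a b c → (F a b c - G a b c) + H a b c) l ≈ (Σ₃ F l - Σ₃ G l) + Σ₃ H l
    Σ₃-lin F G H l = trans (Σ₂-cong (λ a r → sumOver-lin (inner F a) (inner G a) (inner H a) (cuts r)) l)
                           (sumOver-lin (outer F) (outer G) (outer H) (cuts l))
      where
      inner : (List X → List X → List X → K) → List X → List X × List X → K
      inner F a p = F a (proj₁ p) (proj₂ p)
      outer : (List X → List X → List X → K) → List X × List X → K
      outer F p = Σ₂ (F (proj₁ p)) (proj₂ p)

    Σ₂-snoc : ∀ (G : List X → List X → K) l x → Σ₂ G (l ++ x ∷ []) ≈ Σ₂ (λ a c → G a (c ++ x ∷ [])) l + G (l ++ x ∷ []) []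
    Σ₂-snoc G [] x = trans (+-cong refl (+-identityʳ _)) (+-cong (sym (+-identityʳ _)) refl)
    Σ₂-snoc G (y ∷ l) x = begin
        Σ₂ G (y ∷ (l ++ x ∷ []))
      ≡⟨ Σ₂-cons G y (l ++ x ∷ []) ⟩
        G [] (y ∷ (l ++ x ∷ [])) + Σ₂ (λ b c → G (y ∷ b) c) (l ++ x ∷ [])
      ≈⟨ +-cong refl (Σ₂-snoc (λ b c → G (y ∷ b) c) l x) ⟩
        G [] (y ∷ (l ++ x ∷ [])) + (Σ₂ (λ b c → G (y ∷ b) (c ++ x ∷ [])) l + G (y ∷ l ++ x ∷ []) [])
      ≈⟨ sym (+-assoc _ _ _) ⟩
        (G [] (y ∷ (l ++ x ∷ [])) + Σ₂ (λ b c → G (y ∷ b) (c ++ x ∷ [])) l) + G (y ∷ l ++ x ∷ []) []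
      ≡⟨ P.cong (_+ G (y ∷ l ++ x ∷ []) []) (P.sym (Σ₂-cons (λ a c → G a (c ++ x ∷ [])) y l)) ⟩
        Σ₂ (λ a c → G a (c ++ x ∷ [])) (y ∷ l) + G (y ∷ l ++ x ∷ []) [] ∎

    Σ₂-reverse : ∀ (G : List X → List X → K) l → Σ₂ G (reverse l) ≈ Σ₂ (λ a c → G (reverse c) (reverse a)) l
    Σ₂-reverse G [] = refl
    Σ₂-reverse G (x ∷ l) = begin
        Σ₂ G (reverse (x ∷ l))
      ≡⟨ P.cong (Σ₂ G) (unfold-reverse x l) ⟩
        Σ₂ G (reverse l ++ x ∷ [])
      ≈⟨ Σ₂-snoc G (reverse l) x ⟩
        Σ₂ (λ a c → G a (c ++ x ∷ [])) (reverse l) + G (reverse l ++ x ∷ []) []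
      ≈⟨ +-cong (Σ₂-reverse (λ a c → G a (c ++ x ∷ [])) l) refl ⟩
        Σ₂ (λ a c → G (reverse c) (reverse a ++ x ∷ [])) l + G (reverse l ++ x ∷ []) []
      ≈⟨ +-comm _ _ ⟩
        G (reverse l ++ x ∷ []) [] + Σ₂ (λ a c → G (reverse c) (reverse a ++ x ∷ [])) l
      ≈⟨ +-cong (reflexive (P.cong (λ z → G z []) (P.sym (unfold-reverse x l))))
                (Σ₂-cong (λ b c → reflexive (P.cong (G (reverse c)) (P.sym (unfold-reverse x b)))) l) ⟩
        G (reverse (x ∷ l)) [] + Σ₂ (λ b c → G (reverse c) (reverse (x ∷ b))) l
      ≡⟨ P.sym (Σ₂-cons (λ a c → G (reverse c) (reverse a)) x l) ⟩
        Σ₂ (λ a c → G (reverse c) (reverse a)) (x ∷ l) ∎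

    Σ₃-assoc : ∀ (F : List X → List X → List X → K) l → Σ₃ F l ≈ Σ₂ (λ p c → Σ₂ (λ a b → F a b c) p) l
    Σ₃-assoc F [] = refl
    Σ₃-assoc F (x ∷ l) = begin
        Σ₃ F (x ∷ l)
      ≡⟨ Σ₂-cons (λ a r → Σ₂ (F a) r) x l ⟩
        Σ₂ (F []) (x ∷ l) + Σ₃ (λ a → F (x ∷ a)) l
      ≈⟨ +-cong (reflexive (Σ₂-cons (F []) x l)) (Σ₃-assoc (λ a → F (x ∷ a)) l) ⟩
        (F [] [] (x ∷ l) + Σ₂ (λ b c → F [] (x ∷ b) c) l) + Σ₂ (λ p c → Σ₂ (λ a b → F (x ∷ a) b c) p) l
      ≈⟨ trans (+-assoc _ _ _) (+-cong (sym (+-identityʳ _)) refl) ⟩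
        (F [] [] (x ∷ l) + 0#) + (Σ₂ (λ b c → F [] (x ∷ b) c) l + Σ₂ (λ p c → Σ₂ (λ a b → F (x ∷ a) b c) p) l)
      ≈⟨ +-cong refl (sym (Σ₂-+ (λ b c → F [] (x ∷ b) c) (λ p c → Σ₂ (λ a b → F (x ∷ a) b c) p) l)) ⟩
        (F [] [] (x ∷ l) + 0#) + Σ₂ (λ b c → F [] (x ∷ b) c + Σ₂ (λ a b′ → F (x ∷ a) b′ c) b) l
      ≈⟨ +-cong refl (Σ₂-cong (λ b c → reflexive (P.sym (Σ₂-cons (λ a b′ → F a b′ c) x b))) l) ⟩
        (F [] [] (x ∷ l) + 0#) + Σ₂ (λ b c → Σ₂ (λ a b′ → F a b′ c) (x ∷ b)) l
      ≡⟨ P.sym (Σ₂-cons (λ p c → Σ₂ (λ a b → F a b c) p) x l) ⟩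
        Σ₂ (λ p c → Σ₂ (λ a b → F a b c) p) (x ∷ l) ∎

    Σ₃-reverse : ∀ (F : List X → List X → List X → K) l → Σ₃ F (reverse l) ≈ Σ₃ (λ a b c → F (reverse c) (reverse b) (reverse a)) l
    Σ₃-reverse F l = begin
        Σ₃ F (reverse l)
      ≈⟨ Σ₂-reverse (λ a r → Σ₂ (F a) r) l ⟩
        Σ₂ (λ a c → Σ₂ (F (reverse c)) (reverse a)) l
      ≈⟨ Σ₂-cong (λ a c → Σ₂-reverse (F (reverse c)) a) l ⟩
        Σ₂ (λ p q → Σ₂ (λ b c → F (reverse q) (reverse c) (reverse b)) p) l
      ≈⟨ sym (Σ₃-assoc (λ a b c → F (reverse c) (reverse b) (reverse a)) l) ⟩
        Σ₃ (λ a b c → F (reverse c) (reverse b) (reverse a)) l ∎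

    Σ₂-emptyLeft : ∀ (G : List X → List X → K) → (∀ x a c → G (x ∷ a) c ≈ 0#) → ∀ l → Σ₂ G l ≈ G [] l
    Σ₂-emptyLeft G h [] = +-identityʳ _
    Σ₂-emptyLeft G h (x ∷ l) = trans (reflexive (Σ₂-cons G x l))
      (trans (+-cong refl (sumOver-zero (λ p → h x (proj₁ p) (proj₂ p)) (cuts l))) (+-identityʳ _))

    Σ₃-emptyFirst : ∀ (F : List X → List X → List X → K) → (∀ x a b c → F (x ∷ a) b c ≈ 0#) → ∀ l → Σ₃ F l ≈ Σ₂ (F []) l
    Σ₃-emptyFirst F h l = Σ₂-emptyLeft (λ a r → Σ₂ (F a) r) (λ x a c → sumOver-zero (λ p → h x a (proj₁ p) (proj₂ p)) (cuts c)) l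

    Σ₂-emptyRight : ∀ (G : List X → List X → K) → (∀ a y c → G a (y ∷ c) ≈ 0#) → ∀ l → Σ₂ G l ≈ G l []
    Σ₂-emptyRight G h [] = +-identityʳ _
    Σ₂-emptyRight G h (x ∷ l) = trans (reflexive (Σ₂-cons G x l))
      (trans (+-cong (h [] x l) (Σ₂-emptyRight (λ b c → G (x ∷ b) c) (λ a y c → h (x ∷ a) y c) l)) (+-identityˡ _))

    Σ₃-emptyLast : ∀ (F : List X → List X → List X → K) → (∀ a b y c → F a b (y ∷ c) ≈ 0#) → ∀ l → Σ₃ F l ≈ Σ₂ (λ a b → F a b []) l
    Σ₃-emptyLast F h l = Σ₂-cong (λ a r → Σ₂-emptyRight (F a) (h a) r) l

    -- Moving a cut point one letter to the right: a decomposition b c with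
    -- b ≠ ∅ is the same as a decomposition b′ (c₁ ∷ c′) with b = b′ ++ [c₁].
    onNonemptyLeft : (List X → List X → K) → List X → List X → K
    onNonemptyLeft g [] c = 0#
    onNonemptyLeft g (b ∷ bs) c = g (b ∷ bs) c

    extendLeft : (List X → List X → K) → List X → List X → K
    extendLeft g b [] = 0#
    extendLeft g b (c ∷ cs) = g (b ++ c ∷ []) cs

    Σ₂-splitEmptyLeft : ∀ (G : List X → List X → K) l → Σ₂ G l ≈ G [] l + Σ₂ (onNonemptyLeft G) l
    Σ₂-splitEmptyLeft G [] = +-cong refl (sym (+-identityʳ 0#))
    Σ₂-splitEmptyLeft G (x ∷ l) = trans (reflexive (Σ₂-cons G x l))
      (+-cong refl (sym (trans (reflexive (Σ₂-cons (onNonemptyLeft G) x l)) (+-identityˡ _))))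

    Σ₂-moveCut : ∀ (g : List X → List X → K) l → Σ₂ (onNonemptyLeft g) l ≈ Σ₂ (extendLeft g) l
    Σ₂-moveCut g [] = refl
    Σ₂-moveCut g (y ∷ l) = begin
        Σ₂ (onNonemptyLeft g) (y ∷ l)
      ≡⟨ Σ₂-cons (onNonemptyLeft g) y l ⟩
        0# + Σ₂ gy l
      ≈⟨ +-identityˡ _ ⟩
        Σ₂ gy l
      ≈⟨ Σ₂-splitEmptyLeft gy l ⟩
        g (y ∷ []) l + Σ₂ (onNonemptyLeft gy) l
      ≈⟨ +-cong refl (Σ₂-moveCut gy l) ⟩
        g (y ∷ []) l + Σ₂ (extendLeft gy) l
      ≈⟨ +-cong refl (Σ₂-cong extend-cons l) ⟩
        extendLeft g [] (y ∷ l) + Σ₂ (λ b c → extendLeft g (y ∷ b) c) l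
      ≡⟨ P.sym (Σ₂-cons (extendLeft g) y l) ⟩
        Σ₂ (extendLeft g) (y ∷ l) ∎
      where
      gy : List X → List X → K
      gy b c = g (y ∷ b) c
      extend-cons : ∀ b c → extendLeft gy b c ≈ extendLeft g (y ∷ b) c
      extend-cons b [] = refl
      extend-cons b (z ∷ c) = refl

    -- The same for both cut points of a decomposition a b c with a, b ≠ ∅:
    -- it is a b′ (c₁ ∷ c′) re-cut as (a ++ [b₁]) (b′ ++ [c₁]) c′.
    onNonemptyFirstTwo : (List X → List X → List X → K) → List X → List X → List X → K
    onNonemptyFirstTwo f [] b c = 0#
    onNonemptyFirstTwo f (a ∷ as) [] c = 0#
    onNonemptyFirstTwo f (a ∷ as) (b ∷ bs) c = f (a ∷ as) (b ∷ bs) c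

    extendFirstTwo : (List X → List X → List X → K) → List X → List X → List X → K
    extendFirstTwo f a [] c = 0#
    extendFirstTwo f a (b ∷ bs) [] = 0#
    extendFirstTwo f a (b ∷ bs) (c ∷ cs) = f (a ++ b ∷ []) (bs ++ c ∷ []) cs

    Σ₃-moveCuts : ∀ (f : List X → List X → List X → K) l → Σ₃ (onNonemptyFirstTwo f) l ≈ Σ₃ (extendFirstTwo f) l
    Σ₃-moveCuts f [] = refl
    Σ₃-moveCuts f (y ∷ l) = begin
        Σ₃ (onNonemptyFirstTwo f) (y ∷ l)
      ≡⟨ Σ₂-cons (λ a r → Σ₂ (onNonemptyFirstTwo f a) r) y l ⟩
        Σ₂ (onNonemptyFirstTwo f []) (y ∷ l) + Σ₃ (λ a → onNonemptyFirstTwo f (y ∷ a)) l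
      ≈⟨ +-cong (sumOver-zero (λ _ → refl) (cuts (y ∷ l))) refl ⟩
        0# + Σ₃ (λ a → onNonemptyFirstTwo f (y ∷ a)) l
      ≈⟨ +-identityˡ _ ⟩
        Σ₃ (λ a → onNonemptyFirstTwo f (y ∷ a)) l
      ≈⟨ Σ₃-cong split-first l ⟩
        Σ₃ (λ a b c → firstLetterOnly a b c + onNonemptyFirstTwo fy a b c) l
      ≈⟨ Σ₂-cong (λ a r → Σ₂-+ (firstLetterOnly a) (onNonemptyFirstTwo fy a) r) l ⟩
        Σ₂ (λ a r → Σ₂ (firstLetterOnly a) r + Σ₂ (onNonemptyFirstTwo fy a) r) l
      ≈⟨ Σ₂-+ (λ a r → Σ₂ (firstLetterOnly a) r) (λ a r → Σ₂ (onNonemptyFirstTwo fy a) r) l ⟩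
        Σ₃ firstLetterOnly l + Σ₃ (onNonemptyFirstTwo fy) l
      ≈⟨ +-cong (Σ₃-emptyFirst firstLetterOnly (λ x a b c → refl) l) (Σ₃-moveCuts fy l) ⟩
        Σ₂ (onNonemptyLeft (f (y ∷ []))) l + Σ₃ (extendFirstTwo fy) l
      ≈⟨ +-cong (Σ₂-moveCut (f (y ∷ [])) l) (Σ₃-cong extend-cons l) ⟩
        Σ₂ (extendLeft (f (y ∷ []))) l + Σ₃ (λ a → extendFirstTwo f (y ∷ a)) l
      ≈⟨ +-cong (sym (trans (reflexive (Σ₂-cons (extendFirstTwo f []) y l))
                            (trans (+-identityˡ _) (Σ₂-cong extend-nil l)))) refl ⟩
        Σ₂ (extendFirstTwo f []) (y ∷ l) + Σ₃ (λ a → extendFirstTwo f (y ∷ a)) l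
      ≡⟨ P.sym (Σ₂-cons (λ a r → Σ₂ (extendFirstTwo f a) r) y l) ⟩
        Σ₃ (extendFirstTwo f) (y ∷ l) ∎
      where
      fy : List X → List X → List X → K
      fy a b c = f (y ∷ a) b c
      firstLetterOnly : List X → List X → List X → K
      firstLetterOnly [] b c = onNonemptyLeft (f (y ∷ [])) b c
      firstLetterOnly (_ ∷ _) b c = 0#
      split-first : ∀ a b c → onNonemptyFirstTwo f (y ∷ a) b c ≈ firstLetterOnly a b c + onNonemptyFirstTwo fy a b c
      split-first [] [] c = sym (+-identityˡ 0#)
      split-first [] (b ∷ bs) c = sym (+-identityʳ _)
      split-first (x ∷ a) [] c = sym (+-identityˡ 0#)
      split-first (x ∷ a) (b ∷ bs) c = sym (+-identityˡ _)
      extend-cons : ∀ a b c → extendFirstTwo fy a b c ≈ extendFirstTwo f (y ∷ a) b c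
      extend-cons a [] c = refl
      extend-cons a (b ∷ bs) [] = refl
      extend-cons a (b ∷ bs) (c ∷ cs) = refl
      extend-nil : ∀ b c → extendFirstTwo f [] (y ∷ b) c ≈ extendLeft (f (y ∷ [])) b c
      extend-nil b [] = refl
      extend-nil b (c ∷ cs) = refl

  Σ₂-map : ∀ {a b} {X : Set a} {Y : Set b} (G : List Y → List Y → K) (f : X → Y) l →
    Σ₂ G (map f l) ≡ Σ₂ (λ a c → G (map f a) (map f c)) l
  Σ₂-map G f [] = P.refl
  Σ₂-map G f (x ∷ l) = P.trans (Σ₂-cons G (f x) (map f l))
    (P.trans (P.cong (G [] (f x ∷ map f l) +_) (Σ₂-map (λ b c → G (f x ∷ b) c) f l))
             (P.sym (Σ₂-cons (λ a c → G (map f a) (map f c)) x l)))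

  Σ₃-map : ∀ {a b} {X : Set a} {Y : Set b} (F : List Y → List Y → List Y → K) (f : X → Y) l →
    Σ₃ F (map f l) ≈ Σ₃ (λ a b c → F (map f a) (map f b) (map f c)) l
  Σ₃-map F f l = trans (reflexive (Σ₂-map (λ a r → Σ₂ (F a) r) f l))
    (Σ₂-cong (λ a c → reflexive (Σ₂-map (F (map f a)) f c)) l)

  -- Lists of scalars.  psums and diffs (from Defs) are mutually inverse up to
  -- reversal; the variants below carry an explicit offset so that they can be
  -- split along a decomposition of the list.

  total : List K → K
  total = sumK R

  -- the partial sums of a ++ c lying over the letters of c
  psumsAfter : List K → List K → List K
  psumsAfter [] c = psums R c
  psumsAfter (x ∷ a) c = map (x +_) (psumsAfter a c)

  psumsFrom : K → List K → List K
  psumsFrom k [] = []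
  psumsFrom k (x ∷ l) = (k + x) ∷ psumsFrom (k + x) l

  diffsFrom : K → List K → List K
  diffsFrom p [] = []
  diffsFrom p (x ∷ l) = (x - p) ∷ diffsFrom x l

  bumpHead : K → List K → List K
  bumpHead d [] = []
  bumpHead d (x ∷ l) = (d + x) ∷ l

  revDiffs : List K → List K
  revDiffs l = reverse (diffs R l)

  lastOr : K → List K → K
  lastOr d [] = d
  lastOr d (x ∷ l) = lastOr x l

  headOr : K → List K → K
  headOr d [] = d
  headOr d (x ∷ l) = x

  dropLast : List K → List K
  dropLast [] = []
  dropLast (x ∷ []) = []
  dropLast (x ∷ y ∷ l) = x ∷ dropLast (y ∷ l)

  χ : ∀ {a} {X : Set a} → List X → K
  χ [] = 0#
  χ (_ ∷ _) = 1#

  Σ₂-psums : ∀ (G : List K → List K → K) l → Σ₂ G (psums R l) ≡ Σ₂ (λ a c → G (psums R a) (psumsAfter a c)) l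
  Σ₂-psums G [] = P.refl
  Σ₂-psums G (x ∷ l) = P.trans (Σ₂-cons G x (map (x +_) (psums R l)))
    (P.trans (P.cong (G [] (psums R (x ∷ l)) +_)
       (P.trans (Σ₂-map (λ b c → G (x ∷ b) c) (x +_) (psums R l))
                (Σ₂-psums (λ b c → G (x ∷ map (x +_) b) (map (x +_) c)) l)))
     (P.sym (Σ₂-cons (λ a c → G (psums R a) (psumsAfter a c)) x l)))

  Σ₂-psumsAfter : ∀ (G : List K → List K → K) a r →
    Σ₂ G (psumsAfter a r) ≡ Σ₂ (λ b c → G (psumsAfter a b) (psumsAfter (a ++ b) c)) r
  Σ₂-psumsAfter G [] r = Σ₂-psums G r
  Σ₂-psumsAfter G (x ∷ a) r = P.trans (Σ₂-map G (x +_) (psumsAfter a r))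
    (Σ₂-psumsAfter (λ b c → G (map (x +_) b) (map (x +_) c)) a r)

  Σ₃-psums : ∀ (F : List K → List K → List K → K) l →
    Σ₃ F (psums R l) ≈ Σ₃ (λ a b c → F (psums R a) (psumsAfter a b) (psumsAfter (a ++ b) c)) l
  Σ₃-psums F l = trans (reflexive (Σ₂-psums (λ a r → Σ₂ (F a) r) l))
    (Σ₂-cong (λ a c → reflexive (Σ₂-psumsAfter (F (psums R a)) a c)) l)

  open Setoid (PW.setoid setoid)
    using () renaming (_≈_ to _≈*_; refl to ≈*-refl; trans to ≈*-trans; reflexive to ≡⇒≈*)

  total-++ : ∀ a b → total (a ++ b) ≈ total a + total b
  total-++ [] b = sym (+-identityˡ _)
  total-++ (x ∷ a) b = trans (+-cong refl (total-++ a b)) (sym (+-assoc _ _ _))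

  total-snoc : ∀ b x → total (b ++ x ∷ []) ≈ total b + x
  total-snoc b x = trans (total-++ b (x ∷ [])) (+-cong refl (+-identityʳ x))

  lastOr-snoc : ∀ d l x → lastOr d (l ++ x ∷ []) ≡ x
  lastOr-snoc d [] x = P.refl
  lastOr-snoc d (y ∷ l) x = lastOr-snoc y l x

  dropLast-snoc : ∀ l x → dropLast (l ++ x ∷ []) ≡ l
  dropLast-snoc [] x = P.refl
  dropLast-snoc (y ∷ []) x = P.refl
  dropLast-snoc (y ∷ z ∷ l) x = P.cong (y ∷_) (dropLast-snoc (z ∷ l) x)

  lastOr-reverse : ∀ d l → lastOr d (reverse l) ≡ headOr d l
  lastOr-reverse d [] = P.refl
  lastOr-reverse d (y ∷ l) = P.trans (P.cong (lastOr d) (unfold-reverse y l)) (lastOr-snoc d (reverse l) y)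

  headOr-reverse : ∀ d l → headOr d (reverse l) ≡ lastOr d l
  headOr-reverse d l = P.trans (P.sym (lastOr-reverse d (reverse l))) (P.cong (lastOr d) (reverse-involutive l))

  lastOr-cong : ∀ {d d′ l l′} → d ≈ d′ → l ≈* l′ → lastOr d l ≈ lastOr d′ l′
  lastOr-cong e [] = e
  lastOr-cong e (p ∷ ps) = lastOr-cong p ps

  headOr-cong : ∀ {d d′ l l′} → d ≈ d′ → l ≈* l′ → headOr d l ≈ headOr d′ l′
  headOr-cong e [] = e
  headOr-cong e (p ∷ ps) = p

  χ-snoc : ∀ {a} {X : Set a} (l : List X) x → χ (l ++ x ∷ []) ≡ 1#
  χ-snoc [] x = P.refl
  χ-snoc (y ∷ l) x = P.refl

  χ-reverse : ∀ {a} {X : Set a} (l : List X) → χ (reverse l) ≡ χ l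
  χ-reverse [] = P.refl
  χ-reverse (x ∷ l) = P.trans (P.cong χ (unfold-reverse x l)) (χ-snoc (reverse l) x)

  χ-map : ∀ {a b} {X : Set a} {Y : Set b} (f : X → Y) l → χ (map f l) ≡ χ l
  χ-map f [] = P.refl
  χ-map f (x ∷ l) = P.refl

  χ-psumsAfter : ∀ a b → χ (psumsAfter a b) ≡ χ b
  χ-psumsAfter [] [] = P.refl
  χ-psumsAfter [] (x ∷ b) = P.refl
  χ-psumsAfter (x ∷ a) b = P.trans (χ-map (x +_) (psumsAfter a b)) (χ-psumsAfter a b)

  χ-reverse-psumsAfter : ∀ a b → χ (reverse (psumsAfter a b)) ≡ χ b
  χ-reverse-psumsAfter a b = P.trans (χ-reverse (psumsAfter a b)) (χ-psumsAfter a b)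

  χ-reverse-psums : ∀ a → χ (reverse (psums R a)) ≡ χ a
  χ-reverse-psums a = χ-reverse-psumsAfter [] a

  diffsFrom-cong : ∀ {d d′ l l′} → d ≈ d′ → l ≈* l′ → diffsFrom d l ≈* diffsFrom d′ l′
  diffsFrom-cong e [] = []
  diffsFrom-cong e (p ∷ ps) = +-cong p (-‿cong e) ∷ diffsFrom-cong p ps

  psumsFrom-cong : ∀ {k k′} → k ≈ k′ → ∀ l → psumsFrom k l ≈* psumsFrom k′ l
  psumsFrom-cong e [] = []
  psumsFrom-cong e (x ∷ l) = +-cong e refl ∷ psumsFrom-cong (+-cong e refl) l

  bumpHead-cong : ∀ {d d′ l} → d ≈ d′ → bumpHead d l ≈* bumpHead d′ l
  bumpHead-cong {l = []} e = []
  bumpHead-cong {l = x ∷ l} e = +-cong e refl ∷ ≈*-refl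

  subtract-cong : ∀ {h h′ l l′} → h ≈ h′ → l ≈* l′ → map (λ z → z - h) l ≈* map (λ z → z - h′) l′
  subtract-cong e [] = []
  subtract-cong e (p ∷ ps) = +-cong p (-‿cong e) ∷ subtract-cong e ps

  add-cong : ∀ x {l l′} → l ≈* l′ → map (x +_) l ≈* map (x +_) l′
  add-cong x [] = []
  add-cong x (p ∷ ps) = +-cong refl p ∷ add-cong x ps

  diffsFrom-++ : ∀ p l l′ → diffsFrom p (l ++ l′) ≡ diffsFrom p l ++ diffsFrom (lastOr p l) l′
  diffsFrom-++ p [] l′ = P.refl
  diffsFrom-++ p (x ∷ l) l′ = P.cong ((x - p) ∷_) (diffsFrom-++ x l l′)

  diffsFrom-psumsFrom : ∀ k l → diffsFrom k (psumsFrom k l) ≈* l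
  diffsFrom-psumsFrom k [] = []
  diffsFrom-psumsFrom k (x ∷ l) = +-sub-self k x ∷ diffsFrom-psumsFrom (k + x) l

  diffsFrom-psumsFrom′ : ∀ p k l → diffsFrom p (psumsFrom k l) ≈* bumpHead (k - p) l
  diffsFrom-psumsFrom′ p k [] = []
  diffsFrom-psumsFrom′ p k (x ∷ l) = +-sub k x p ∷ diffsFrom-psumsFrom (k + x) l

  lastOr-psumsFrom : ∀ k l → lastOr k (psumsFrom k l) ≈ k + total l
  lastOr-psumsFrom k [] = sym (+-identityʳ k)
  lastOr-psumsFrom k (x ∷ l) = trans (lastOr-psumsFrom (k + x) l) (+-assoc _ _ _)

  add-psumsFrom : ∀ x k l → map (x +_) (psumsFrom k l) ≈* psumsFrom (x + k) l
  add-psumsFrom x k [] = []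
  add-psumsFrom x k (y ∷ l) = sym (+-assoc x k y) ∷ ≈*-trans (add-psumsFrom x (k + y) l) (psumsFrom-cong (sym (+-assoc x k y)) l)

  subtract-psumsFrom : ∀ h k l → map (λ z → z - h) (psumsFrom k l) ≈* psumsFrom (k - h) l
  subtract-psumsFrom h k [] = []
  subtract-psumsFrom h k (x ∷ l) = +-sub k x h ∷ ≈*-trans (subtract-psumsFrom h (k + x) l) (psumsFrom-cong (+-sub k x h) l)

  add-psums : ∀ k l → map (k +_) (psums R l) ≈* psumsFrom k l
  add-psums k [] = []
  add-psums k (x ∷ l) = refl ∷ ≈*-trans (≡⇒≈* (P.sym (map-∘ (psums R l))))
     (≈*-trans (reassociate (psums R l)) (add-psums (k + x) l))
    where
    reassociate : ∀ l → map (λ z → k + (x + z)) l ≈* map ((k + x) +_) l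
    reassociate [] = []
    reassociate (z ∷ l) = sym (+-assoc k x z) ∷ reassociate l

  psums≈psumsFrom : ∀ l → psums R l ≈* psumsFrom 0# l
  psums≈psumsFrom l = ≈*-trans (add-zero (psums R l)) (add-psums 0# l)
    where
    add-zero : ∀ l → l ≈* map (0# +_) l
    add-zero [] = []
    add-zero (z ∷ l) = sym (+-identityˡ z) ∷ add-zero l

  psumsAfter≈psumsFrom : ∀ a l → psumsAfter a l ≈* psumsFrom (total a) l
  psumsAfter≈psumsFrom [] l = psums≈psumsFrom l
  psumsAfter≈psumsFrom (x ∷ a) l = ≈*-trans (add-cong x (psumsAfter≈psumsFrom a l)) (add-psumsFrom x (total a) l)

  lastOr-psums : ∀ l → lastOr 0# (psums R l) ≈ total l
  lastOr-psums l = trans (lastOr-cong refl (psums≈psumsFrom l)) (trans (lastOr-psumsFrom 0# l) (+-identityˡ _))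

  diffsFrom-psums : ∀ l → diffsFrom 0# (psums R l) ≈* l
  diffsFrom-psums l = ≈*-trans (diffsFrom-cong refl (psums≈psumsFrom l)) (diffsFrom-psumsFrom 0# l)

  diffs≈reverse-diffsFrom : ∀ l → diffs R l ≈* reverse (diffsFrom 0# (reverse l))
  diffs≈reverse-diffsFrom [] = []
  diffs≈reverse-diffsFrom (x ∷ []) = sym (x-0≈x x) ∷ []
  diffs≈reverse-diffsFrom (x ∷ x′ ∷ l) = ≈*-trans (refl ∷ diffs≈reverse-diffsFrom (x′ ∷ l)) (≡⇒≈* (P.sym unfold))
    where
    l′ = x′ ∷ l
    unfold : reverse (diffsFrom 0# (reverse (x ∷ l′))) ≡ (x - x′) ∷ reverse (diffsFrom 0# (reverse l′))
    unfold = P.trans (P.cong (λ z → reverse (diffsFrom 0# z)) (unfold-reverse x l′))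
         (P.trans (P.cong reverse (diffsFrom-++ 0# (reverse l′) (x ∷ [])))
         (P.trans (reverse-++ (diffsFrom 0# (reverse l′)) (diffsFrom (lastOr 0# (reverse l′)) (x ∷ [])))
           (P.cong (λ z → (x - z) ∷ reverse (diffsFrom 0# (reverse l′))) (lastOr-reverse 0# l′))))

  revDiffs-reverse : ∀ l → revDiffs (reverse l) ≈* diffsFrom 0# l
  revDiffs-reverse l = ≈*-trans (PW.reverse⁺ (diffs≈reverse-diffsFrom (reverse l)))
    (≡⇒≈* (P.trans (reverse-involutive _) (P.cong (diffsFrom 0#) (reverse-involutive l))))

  revDiffs-subtract-reverse : ∀ (h : K) l → revDiffs (map (λ z → z - h) (reverse l)) ≈* diffsFrom 0# (map (λ z → z - h) l)
  revDiffs-subtract-reverse h l = ≈*-trans (≡⇒≈* (P.cong revDiffs (reverse-map (λ z → z - h) l))) (revDiffs-reverse _)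

  -- At the swap point the lower row is reverse (psums x); a decomposition
  -- x = a b c shows up there through the blocks reverse (psums a),
  -- reverse (psumsAfter a b) and reverse (psumsAfter (a ++ b) c).  The
  -- following lemmas recover the arguments that swapped moulds see.

  revDiffs-reverse-psums : ∀ a → revDiffs (reverse (psums R a)) ≈* a
  revDiffs-reverse-psums a = ≈*-trans (revDiffs-reverse (psums R a)) (diffsFrom-psums a)

  revDiffs-reverse-psumsAfter : ∀ a c → revDiffs (reverse (psumsAfter a c)) ≈* bumpHead (total a) c
  revDiffs-reverse-psumsAfter a c = ≈*-trans (revDiffs-reverse _)
    (≈*-trans (diffsFrom-cong refl (psumsAfter≈psumsFrom a c))
    (≈*-trans (diffsFrom-psumsFrom′ 0# (total a) c) (bumpHead-cong (x-0≈x _))))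

  -- removing the block over b from the partial sums of a ++ b ++ c
  revDiffs-gap : ∀ a b c → revDiffs (reverse (psumsAfter (a ++ b) c) ++ reverse (psums R a)) ≈* a ++ bumpHead (total b) c
  revDiffs-gap a b c = ≈*-trans (≡⇒≈* (P.cong revDiffs (P.sym (reverse-++ p t))))
    (≈*-trans (revDiffs-reverse (p ++ t)) (≈*-trans (≡⇒≈* (diffsFrom-++ 0# p t)) (PW.++⁺ (diffsFrom-psums a) afterGap)))
    where
    p = psums R a
    t = psumsAfter (a ++ b) c
    afterGap : diffsFrom (lastOr 0# p) t ≈* bumpHead (total b) c
    afterGap = ≈*-trans (diffsFrom-cong (lastOr-psums a) (psumsAfter≈psumsFrom (a ++ b) c))
      (≈*-trans (diffsFrom-psumsFrom′ (total a) (total (a ++ b)) c)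
                (bumpHead-cong (trans (+-cong (total-++ a b) refl) (+-sub-self (total a) (total b)))))

  -- the block over b, re-based at the last partial sum of a
  revDiffs-block : ∀ a b → revDiffs (map (λ z → z - headOr 0# (reverse (psums R a))) (reverse (psumsAfter a b))) ≈* b
  revDiffs-block a b = ≈*-trans (revDiffs-subtract-reverse _ (psumsAfter a b))
    (≈*-trans (diffsFrom-cong refl (subtract-cong base (psumsAfter≈psumsFrom a b)))
    (≈*-trans (diffsFrom-cong refl (subtract-psumsFrom (total a) (total a) b))
    (≈*-trans (diffsFrom-cong refl (psumsFrom-cong (-‿inverseʳ (total a)) b)) (diffsFrom-psumsFrom 0# b))))
    where
    base : headOr 0# (reverse (psums R a)) ≈ total a
    base = trans (reflexive (headOr-reverse 0# (psums R a))) (lastOr-psums a)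

  -- the block over b₁ ∷ b, re-based at the first partial sum over c₁ ∷ c:
  -- its differences are b preceded by -(b + c₁), the shape on which push acts
  revDiffs-lowerBlock : ∀ a b₁ b c₁ c →
    revDiffs (map (λ z → z - lastOr 0# (reverse (psumsAfter (a ++ b₁ ∷ b) (c₁ ∷ c)))) (reverse (psumsAfter a (b₁ ∷ b))))
      ≈* (- total (b ++ c₁ ∷ [])) ∷ b
  revDiffs-lowerBlock a b₁ b c₁ c = ≈*-trans (revDiffs-subtract-reverse _ (psumsAfter a (b₁ ∷ b)))
    (≈*-trans (diffsFrom-cong refl (subtract-cong base (psumsAfter≈psumsFrom a (b₁ ∷ b))))
    (≈*-trans (diffsFrom-cong refl (subtract-psumsFrom h (total a) (b₁ ∷ b)))
    (≈*-trans (diffsFrom-psumsFrom′ 0# (total a - h) (b₁ ∷ b)) (headValue ∷ ≈*-refl))))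
    where
    h = total (a ++ b₁ ∷ b) + c₁
    t = psumsAfter (a ++ b₁ ∷ b) (c₁ ∷ c)
    base : lastOr 0# (reverse t) ≈ h
    base = trans (reflexive (lastOr-reverse 0# t)) (headOr-cong refl (psumsAfter≈psumsFrom (a ++ b₁ ∷ b) (c₁ ∷ c)))
    headValue : ((total a - h) - 0#) + b₁ ≈ - total (b ++ c₁ ∷ [])
    headValue = trans (+-cong (+-cong (+-cong refl (-‿cong (+-cong (total-++ a (b₁ ∷ b)) refl))) refl) refl)
                      (trans (cancel-lower (total a) b₁ (total b) c₁) (-‿cong (sym (total-snoc b c₁))))

  us : Word R → List K
  us = map proj₁

  vs : Word R → List K
  vs = map proj₂

  upperWord : List K → Word R
  upperWord = map (λ x → (x , 0#))

  us-upperWord : ∀ l → us (upperWord l) ≡ l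
  us-upperWord [] = P.refl
  us-upperWord (x ∷ l) = P.cong (x ∷_) (us-upperWord l)

  us-shiftV : ∀ v w → us (shiftV R v w) ≡ us w
  us-shiftV v [] = P.refl
  us-shiftV v (x ∷ w) = P.cong (proj₁ x ∷_) (us-shiftV v w)

  vs-shiftV : ∀ v w → vs (shiftV R v w) ≡ map (λ z → z - v) (vs w)
  vs-shiftV v [] = P.refl
  vs-shiftV v (x ∷ w) = P.cong ((proj₂ x - v) ∷_) (vs-shiftV v w)

  lastView-snoc : ∀ (a : Word R) x → lastView R (a ++ x ∷ []) ≡ snoc a x
  lastView-snoc [] x = P.refl
  lastView-snoc (y ∷ a) x rewrite lastView-snoc a x = P.refl

  module _ {X Y : Set c} where
    map-proj₁-zip : (xs : List X) (ys : List Y) → length xs ≡ length ys → map proj₁ (zip xs ys) ≡ xs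
    map-proj₁-zip [] [] e = P.refl
    map-proj₁-zip (x ∷ xs) (y ∷ ys) e = P.cong (x ∷_) (map-proj₁-zip xs ys (suc-injective e))

    map-proj₂-zip : (xs : List X) (ys : List Y) → length xs ≡ length ys → map proj₂ (zip xs ys) ≡ ys
    map-proj₂-zip [] [] e = P.refl
    map-proj₂-zip (x ∷ xs) (y ∷ ys) e = P.cong (y ∷_) (map-proj₂-zip xs ys (suc-injective e))

  length-diffs : ∀ l → length (diffs R l) ≡ length l
  length-diffs [] = P.refl
  length-diffs (x ∷ []) = P.refl
  length-diffs (x ∷ y ∷ l) = P.cong suc (length-diffs (y ∷ l))

  length-psums : ∀ l → length (psums R l) ≡ length l
  length-psums [] = P.refl
  length-psums (x ∷ l) = P.cong suc (P.trans (length-map (x +_) (psums R l)) (length-psums l))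

  -- swap M w = M (swapPoint w)
  swapPoint : Word R → Word R
  swapPoint w = zip (revDiffs (vs w)) (reverse (psums R (us w)))

  swapPoint-rows : ∀ w → length (revDiffs (vs w)) ≡ length (reverse (psums R (us w)))
  swapPoint-rows w = P.trans (length-reverse (diffs R (vs w))) (P.trans (length-diffs (vs w)) (P.trans (length-map proj₂ w)
     (P.sym (P.trans (length-reverse (psums R (us w))) (P.trans (length-psums (us w)) (length-map proj₁ w))))))

  us-swapPoint : ∀ w → us (swapPoint w) ≡ revDiffs (vs w)
  us-swapPoint w = map-proj₁-zip _ _ (swapPoint-rows w)

  vs-swapPoint : ∀ w → vs (swapPoint w) ≡ reverse (psums R (us w))
  vs-swapPoint w = map-proj₂-zip _ _ (swapPoint-rows w)

  module Mould (A : Bimould R) (cA : Congruent R A) (iA : InARI R A) where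
    α : List K → K
    α l = A (upperWord l)

    A≈α : ∀ w → A w ≈ α (us w)
    A≈α w = proj₁ iA w (upperWord (us w)) (P.sym (us-upperWord (us w)))

    α-cong : ∀ {l l′} → l ≈* l′ → α l ≈ α l′
    α-cong {l} {l′} e = cA (upperWord l) (upperWord l′) (lift e)
      where
      lift : ∀ {l l′} → l ≈* l′ → Pointwise (λ p q → (proj₁ p ≈ proj₁ q) × (proj₂ p ≈ proj₂ q)) (upperWord l) (upperWord l′)
      lift [] = []
      lift (p ∷ ps) = (p , refl) ∷ lift ps

    α[] : α [] ≈ 0#
    α[] = proj₂ iA

    swap≈α : ∀ w → swap R A w ≈ α (revDiffs (vs w))
    swap≈α w = trans (A≈α (swapPoint w)) (reflexive (P.cong α (us-swapPoint w)))

    push≈α : (∀ w → push R A w ≈ A w) → ∀ l y → α (- total (l ++ y ∷ []) ∷ l) ≈ α (l ++ y ∷ [])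
    push≈α pA l y = begin
        α (- total (l ++ y ∷ []) ∷ l)
      ≈⟨ α-cong (-‿cong (reflexive (P.cong total (P.sym us-w))) ∷ ≡⇒≈* (P.sym (P.trans (us-shiftV 0# (upperWord l)) (us-upperWord l)))) ⟩
        α (us ((- sumU R w , - 0#) ∷ shiftV R 0# (upperWord l)))
      ≈⟨ sym (A≈α _) ⟩
        A ((- sumU R w , - 0#) ∷ shiftV R 0# (upperWord l))
      ≡⟨ P.cong (λ v → pushAux R w v A) (P.sym (lastView-snoc (upperWord l) (y , 0#))) ⟩
        push R A w
      ≈⟨ pA w ⟩
        A w
      ≈⟨ A≈α w ⟩
        α (us w)
      ≡⟨ P.cong α us-w ⟩
        α (l ++ y ∷ []) ∎
      where
      w = upperWord l ++ (y , 0#) ∷ []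
      us-w : us w ≡ l ++ y ∷ []
      us-w = P.trans (map-++ proj₁ (upperWord l) _) (P.cong (_++ y ∷ []) (us-upperWord l))

  Σ₂-swapPoint : ∀ (G : List K → List K → K) w →
    Σ₂ (λ a c → G (vs a) (vs c)) (swapPoint w) ≈ Σ₂ (λ a c → G (reverse (psumsAfter a c)) (reverse (psums R a))) (us w)
  Σ₂-swapPoint G w = begin
      Σ₂ (λ a c → G (vs a) (vs c)) (swapPoint w)
    ≡⟨ P.sym (Σ₂-map G proj₂ (swapPoint w)) ⟩
      Σ₂ G (vs (swapPoint w))
    ≡⟨ P.cong (Σ₂ G) (vs-swapPoint w) ⟩
      Σ₂ G (reverse (psums R (us w)))
    ≈⟨ Σ₂-reverse G (psums R (us w)) ⟩
      Σ₂ (λ a c → G (reverse c) (reverse a)) (psums R (us w))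
    ≡⟨ Σ₂-psums (λ a c → G (reverse c) (reverse a)) (us w) ⟩
      Σ₂ (λ a c → G (reverse (psumsAfter a c)) (reverse (psums R a))) (us w) ∎

  Σ₃-swapPoint : ∀ (F : List K → List K → List K → K) w →
    Σ₃ (λ a b c → F (vs a) (vs b) (vs c)) (swapPoint w)
      ≈ Σ₃ (λ a b c → F (reverse (psumsAfter (a ++ b) c)) (reverse (psumsAfter a b)) (reverse (psums R a))) (us w)
  Σ₃-swapPoint F w = begin
      Σ₃ (λ a b c → F (vs a) (vs b) (vs c)) (swapPoint w)
    ≈⟨ sym (Σ₃-map F proj₂ (swapPoint w)) ⟩
      Σ₃ F (vs (swapPoint w))
    ≡⟨ P.cong (Σ₃ F) (vs-swapPoint w) ⟩
      Σ₃ F (reverse (psums R (us w)))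
    ≈⟨ Σ₃-reverse F (psums R (us w)) ⟩
      Σ₃ (λ a b c → F (reverse c) (reverse b) (reverse a)) (psums R (us w))
    ≈⟨ Σ₃-psums (λ a b c → F (reverse c) (reverse b) (reverse a)) (us w) ⟩
      Σ₃ (λ a b c → F (reverse (psumsAfter (a ++ b) c)) (reverse (psumsAfter a b)) (reverse (psums R a))) (us w) ∎

  -- Term-by-term evaluation for a pair A, B of congruent moulds in ARI; only
  -- the push-invariance of B is used.
  module Evaluation (A B : Bimould R) (cA : Congruent R A) (cB : Congruent R B)
                    (iA : InARI R A) (iB : InARI R B) (pB : ∀ w → push R B w ≈ B w) where
    open Mould A cA iA
    open Mould B cB iB using () renaming (α to β; A≈α to B≈β; α-cong to β-cong; α[] to β[]; swap≈α to swap≈β; push≈α to push≈β)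

    sA sB : Bimould R
    sA = swap R A
    sB = swap R B

    -- The terms of ari(sA, sB), as functions of the lower rows P, Q, T of
    -- the three factors; the factors χ record when a term is present.
    swapUpper : List K → List K → List K → K
    swapUpper P Q T = χ Q * ((α (revDiffs (P ++ T)) * β (revDiffs (map (λ z → z - headOr 0# T) Q))) * χ T)

    swapLower : List K → List K → List K → K
    swapLower P Q T = χ P * (χ Q * (α (revDiffs (P ++ T)) * β (revDiffs (map (λ z → z - lastOr 0# P) Q))))

    swapMu : List K → List K → K
    swapMu P T = α (revDiffs P) * β (revDiffs T)

    -- The terms of ari(A, B), as functions of the upper rows a, b, c; the
    -- lower term is onNonemptyFirstTwo lowerCore.
    upperU : List K → List K → List K → K
    upperU a b c = χ b * (χ c * (α (a ++ bumpHead (total b) c) * β b))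

    lowerCore : List K → List K → List K → K
    lowerCore a b c = α (dropLast a ++ (lastOr 0# a + total b) ∷ c) * β b

    swapUpper≈ : ∀ a b c → upperTerm R sA sB a b c ≈ swapUpper (vs a) (vs b) (vs c)
    swapUpper≈ a [] c = sym (zeroˡ _)
    swapUpper≈ a (b₁ ∷ b) [] = sym (trans (*-identityˡ _) (zeroʳ _))
    swapUpper≈ a (b₁ ∷ b) ((u , v) ∷ c) = begin
        sA (a ++ (sumU R (b₁ ∷ b) + u , v) ∷ c) * sB (shiftV R v (b₁ ∷ b))
      ≈⟨ *-cong (swap≈α (a ++ (sumU R (b₁ ∷ b) + u , v) ∷ c)) (swap≈β (shiftV R v (b₁ ∷ b))) ⟩
        α (revDiffs (vs (a ++ (sumU R (b₁ ∷ b) + u , v) ∷ c))) * β (revDiffs (vs (shiftV R v (b₁ ∷ b))))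
      ≡⟨ P.cong₂ (λ p q → α (revDiffs p) * β (revDiffs q)) (map-++ proj₂ a _) (vs-shiftV v (b₁ ∷ b)) ⟩
        α (revDiffs (vs a ++ v ∷ vs c)) * β (revDiffs (map (λ z → z - v) (vs (b₁ ∷ b))))
      ≈⟨ sym (trans (*-identityˡ _) (*-identityʳ _)) ⟩
        swapUpper (vs a) (vs (b₁ ∷ b)) (vs ((u , v) ∷ c)) ∎

    swapLower-snoc : ∀ P v Q T → swapLower (P ++ v ∷ []) Q T ≈ χ Q * (α (revDiffs (P ++ v ∷ T)) * β (revDiffs (map (λ z → z - v) Q)))
    swapLower-snoc P v Q T rewrite χ-snoc P v | lastOr-snoc 0# P v | ++-assoc P (v ∷ []) T = *-identityˡ _

    swapLower≈ : ∀ a b c → lowerTerm R sA sB a b c ≈ swapLower (vs a) (vs b) (vs c)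
    swapLower≈ a [] c = sym (trans (*-cong refl (zeroˡ _)) (zeroʳ _))
    swapLower≈ a (b₁ ∷ b) c with lastView R a
    swapLower≈ .[] (b₁ ∷ b) c | empty = sym (zeroˡ _)
    swapLower≈ .(a′ ++ (u , v) ∷ []) (b₁ ∷ b) c | snoc a′ (u , v) = begin
        sA (a′ ++ (u + sumU R (b₁ ∷ b) , v) ∷ c) * sB (shiftV R v (b₁ ∷ b))
      ≈⟨ *-cong (swap≈α (a′ ++ (u + sumU R (b₁ ∷ b) , v) ∷ c)) (swap≈β (shiftV R v (b₁ ∷ b))) ⟩
        α (revDiffs (vs (a′ ++ (u + sumU R (b₁ ∷ b) , v) ∷ c))) * β (revDiffs (vs (shiftV R v (b₁ ∷ b))))
      ≡⟨ P.cong₂ (λ p q → α (revDiffs p) * β (revDiffs q)) (map-++ proj₂ a′ _) (vs-shiftV v (b₁ ∷ b)) ⟩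
        α (revDiffs (vs a′ ++ v ∷ vs c)) * β (revDiffs (map (λ z → z - v) (vs (b₁ ∷ b))))
      ≈⟨ sym (*-identityˡ _) ⟩
        χ (vs (b₁ ∷ b)) * (α (revDiffs (vs a′ ++ v ∷ vs c)) * β (revDiffs (map (λ z → z - v) (vs (b₁ ∷ b)))))
      ≈⟨ sym (swapLower-snoc (vs a′) v (vs (b₁ ∷ b)) (vs c)) ⟩
        swapLower (vs a′ ++ v ∷ []) (vs (b₁ ∷ b)) (vs c)
      ≡⟨ P.cong (λ p → swapLower p (vs (b₁ ∷ b)) (vs c)) (P.sym (map-++ proj₂ a′ ((u , v) ∷ []))) ⟩
        swapLower (vs (a′ ++ (u , v) ∷ [])) (vs (b₁ ∷ b)) (vs c) ∎

    swapMu≈ : ∀ a c → sA a * sB c ≈ swapMu (vs a) (vs c)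
    swapMu≈ a c = *-cong (swap≈α a) (swap≈β c)

    upper≈ : ∀ a b c → upperTerm R A B a b c ≈ upperU (us a) (us b) (us c)
    upper≈ a [] c = sym (zeroˡ _)
    upper≈ a (b₁ ∷ b) [] = sym (trans (*-identityˡ _) (zeroˡ _))
    upper≈ a (b₁ ∷ b) ((u , v) ∷ c) = begin
        A (a ++ (sumU R (b₁ ∷ b) + u , v) ∷ c) * B (shiftV R v (b₁ ∷ b))
      ≈⟨ *-cong (A≈α _) (B≈β _) ⟩
        α (us (a ++ (sumU R (b₁ ∷ b) + u , v) ∷ c)) * β (us (shiftV R v (b₁ ∷ b)))
      ≡⟨ P.cong₂ (λ p q → α p * β q) (map-++ proj₁ a _) (us-shiftV v (b₁ ∷ b)) ⟩
        α (us a ++ bumpHead (total (us (b₁ ∷ b))) (u ∷ us c)) * β (us (b₁ ∷ b))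
      ≈⟨ sym (trans (*-identityˡ _) (*-identityˡ _)) ⟩
        upperU (us a) (us (b₁ ∷ b)) (us ((u , v) ∷ c)) ∎

    lowerCore-nonempty : ∀ a y q b c →
      onNonemptyFirstTwo lowerCore (a ++ y ∷ []) (q ∷ b) c ≈ α (a ++ (y + total (q ∷ b)) ∷ c) * β (q ∷ b)
    lowerCore-nonempty a y q b c = trans (present a)
      (reflexive (P.cong₂ (λ p r → α (p ++ (r + total (q ∷ b)) ∷ c) * β (q ∷ b)) (dropLast-snoc a y) (lastOr-snoc 0# a y)))
      where
      present : ∀ a → onNonemptyFirstTwo lowerCore (a ++ y ∷ []) (q ∷ b) c ≈ lowerCore (a ++ y ∷ []) (q ∷ b) c
      present [] = refl
      present (x ∷ a) = refl

    lower≈ : ∀ a b c → lowerTerm R A B a b c ≈ onNonemptyFirstTwo lowerCore (us a) (us b) (us c)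
    lower≈ [] [] c = refl
    lower≈ (_ ∷ _) [] c = refl
    lower≈ a (b₁ ∷ b) c with lastView R a
    lower≈ .[] (b₁ ∷ b) c | empty = refl
    lower≈ .(a′ ++ (u , v) ∷ []) (b₁ ∷ b) c | snoc a′ (u , v) = begin
        A (a′ ++ (u + sumU R (b₁ ∷ b) , v) ∷ c) * B (shiftV R v (b₁ ∷ b))
      ≈⟨ *-cong (A≈α _) (B≈β _) ⟩
        α (us (a′ ++ (u + sumU R (b₁ ∷ b) , v) ∷ c)) * β (us (shiftV R v (b₁ ∷ b)))
      ≡⟨ P.cong₂ (λ p q → α p * β q) (map-++ proj₁ a′ _) (us-shiftV v (b₁ ∷ b)) ⟩
        α (us a′ ++ (u + total (us (b₁ ∷ b))) ∷ us c) * β (us (b₁ ∷ b))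
      ≈⟨ sym (lowerCore-nonempty (us a′) u (proj₁ b₁) (us b) (us c)) ⟩
        onNonemptyFirstTwo lowerCore (us a′ ++ u ∷ []) (us (b₁ ∷ b)) (us c)
      ≡⟨ P.cong (λ p → onNonemptyFirstTwo lowerCore p (us (b₁ ∷ b)) (us c)) (P.sym (map-++ proj₁ a′ ((u , v) ∷ []))) ⟩
        onNonemptyFirstTwo lowerCore (us (a′ ++ (u , v) ∷ [])) (us (b₁ ∷ b)) (us c) ∎

    mu≈ : ∀ a c → A a * B c ≈ α (us a) * β (us c)
    mu≈ a c = *-cong (A≈α a) (B≈β c)

    swapUpperAt : List K → List K → List K → K
    swapUpperAt a b c = χ b * ((α (a ++ bumpHead (total b) c) * β b) * χ a)

    swapUpper-at : ∀ a b c →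
      swapUpper (reverse (psumsAfter (a ++ b) c)) (reverse (psumsAfter a b)) (reverse (psums R a)) ≈ swapUpperAt a b c
    swapUpper-at a b c = *-cong (reflexive (χ-reverse-psumsAfter a b))
      (*-cong (*-cong (α-cong (revDiffs-gap a b c)) (β-cong (revDiffs-block a b))) (reflexive (χ-reverse-psums a)))

    swapMu-at : ∀ a c → swapMu (reverse (psumsAfter a c)) (reverse (psums R a)) ≈ α (bumpHead (total a) c) * β a
    swapMu-at a c = *-cong (α-cong (revDiffs-reverse-psumsAfter a c)) (β-cong (revDiffs-reverse-psums a))

    -- the only place where push-invariance enters
    swapLower-at : ∀ a b c →
      swapLower (reverse (psumsAfter (a ++ b) c)) (reverse (psumsAfter a b)) (reverse (psums R a)) ≈ extendFirstTwo lowerCore a b c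
    swapLower-at a [] c = trans (*-cong refl (trans (*-cong (reflexive (χ-reverse-psumsAfter a [])) refl) (zeroˡ _))) (zeroʳ _)
    swapLower-at a (b₁ ∷ b) [] = trans (*-cong (reflexive (χ-reverse-psumsAfter (a ++ b₁ ∷ b) [])) refl) (zeroˡ _)
    swapLower-at a (b₁ ∷ b) (c₁ ∷ c) = begin
        swapLower (reverse (psumsAfter (a ++ b₁ ∷ b) (c₁ ∷ c))) (reverse (psumsAfter a (b₁ ∷ b))) (reverse (psums R a))
      ≈⟨ *-cong (reflexive (χ-reverse-psumsAfter (a ++ b₁ ∷ b) (c₁ ∷ c)))
           (*-cong (reflexive (χ-reverse-psumsAfter a (b₁ ∷ b)))
             (*-cong (α-cong (revDiffs-gap a (b₁ ∷ b) (c₁ ∷ c))) (β-cong (revDiffs-lowerBlock a b₁ b c₁ c)))) ⟩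
        1# * (1# * (α (a ++ ((b₁ + total b) + c₁) ∷ c) * β (- total (b ++ c₁ ∷ []) ∷ b)))
      ≈⟨ trans (*-identityˡ _) (*-identityˡ _) ⟩
        α (a ++ ((b₁ + total b) + c₁) ∷ c) * β (- total (b ++ c₁ ∷ []) ∷ b)
      ≈⟨ *-cong (α-cong (PW.++⁺ ≈*-refl (regroup ∷ ≈*-refl))) (push≈β pB b c₁) ⟩
        α (a ++ (b₁ + total (b ++ c₁ ∷ [])) ∷ c) * β (b ++ c₁ ∷ [])
      ≡⟨ P.sym (P.cong₂ (λ p r → α (p ++ (r + total (b ++ c₁ ∷ [])) ∷ c) * β (b ++ c₁ ∷ []))
                        (dropLast-snoc a b₁) (lastOr-snoc 0# a b₁)) ⟩
        extendFirstTwo lowerCore a (b₁ ∷ b) (c₁ ∷ c) ∎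
      where
      regroup : (b₁ + total b) + c₁ ≈ b₁ + total (b ++ c₁ ∷ [])
      regroup = trans (+-assoc _ _ _) (+-cong refl (sym (total-snoc b c₁)))

    upperEmptyFirst : List K → List K → List K → K
    upperEmptyFirst [] b c = upperU [] b c
    upperEmptyFirst (_ ∷ _) b c = 0#

    -- the terms of mu(A, B), as triples with empty last factor
    muTriple : List K → List K → List K → K
    muTriple a b [] = α a * β b
    muTriple a b (_ ∷ _) = 0#

    -- A re-indexed upper term of ari(sA, sB) is the corresponding upper term
    -- of ari(A, B), except that terms with a = ∅ are missing and terms with
    -- c = ∅ contribute to mu(A, B).
    swapUpperAt-split : ∀ a b c → swapUpperAt a b c ≈ (upperU a b c - upperEmptyFirst a b c) + muTriple a b c
    swapUpperAt-split [] b [] = trans (trans (*-cong refl (zeroʳ _)) (zeroʳ _))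
      (sym (trans (+-cong (-‿inverseʳ _) (trans (*-cong α[] refl) (zeroˡ _))) (+-identityʳ 0#)))
    swapUpperAt-split [] b (c₁ ∷ c) = trans (trans (*-cong refl (zeroʳ _)) (zeroʳ _)) (sym (trans (+-identityʳ _) (-‿inverseʳ _)))
    swapUpperAt-split (x ∷ a) [] [] = trans (zeroˡ _)
      (sym (trans (+-cong (trans (+-cong (zeroˡ _) (-‿cong refl)) (-‿inverseʳ 0#)) (trans (*-cong refl β[]) (zeroʳ _))) (+-identityʳ 0#)))
    swapUpperAt-split (x ∷ a) [] (c₁ ∷ c) = trans (zeroˡ _) (trans 0≈0-0+0 (+-cong (+-cong (sym (zeroˡ _)) refl) refl))
    swapUpperAt-split (x ∷ a) (y ∷ b) [] = begin
        1# * ((α ((x ∷ a) ++ []) * β (y ∷ b)) * 1#)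
      ≈⟨ trans (*-identityˡ _) (*-identityʳ _) ⟩
        α ((x ∷ a) ++ []) * β (y ∷ b)
      ≡⟨ P.cong (λ z → α z * β (y ∷ b)) (++-identityʳ (x ∷ a)) ⟩
        α (x ∷ a) * β (y ∷ b)
      ≈⟨ sym (+-identityˡ _) ⟩
        0# + α (x ∷ a) * β (y ∷ b)
      ≈⟨ +-cong (sym (trans (+-cong (trans (*-identityˡ _) (zeroˡ _)) refl) (-‿inverseʳ 0#))) refl ⟩
        (upperU (x ∷ a) (y ∷ b) [] - 0#) + α (x ∷ a) * β (y ∷ b) ∎
    swapUpperAt-split (x ∷ a) (y ∷ b) (c₁ ∷ c) = begin
        1# * ((α ((x ∷ a) ++ bumpHead (total (y ∷ b)) (c₁ ∷ c)) * β (y ∷ b)) * 1#)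
      ≈⟨ trans (*-identityˡ _) (trans (*-identityʳ _) (sym (trans (*-identityˡ _) (*-identityˡ _)))) ⟩
        upperU (x ∷ a) (y ∷ b) (c₁ ∷ c)
      ≈⟨ sym (trans (+-identityʳ _) (x-0≈x _)) ⟩
        (upperU (x ∷ a) (y ∷ b) (c₁ ∷ c) - 0#) + 0# ∎

    swapMuAt≈upper : ∀ b c → α (bumpHead (total b) c) * β b ≈ upperU [] b c
    swapMuAt≈upper [] c = trans (trans (*-cong refl β[]) (zeroʳ _)) (sym (zeroˡ _))
    swapMuAt≈upper (y ∷ b) [] = trans (trans (*-cong α[] refl) (zeroˡ _)) (sym (trans (*-identityˡ _) (zeroˡ _)))
    swapMuAt≈upper (y ∷ b) (c₁ ∷ c) = sym (trans (*-identityˡ _) (*-identityˡ _))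

    -- D(w) = Σ_{x = bc} A(b⌈c) B(b⌋), x the upper row of w
    emptyFirstUpper : Word R → K
    emptyFirstUpper w = Σ₂ (upperU []) (us w)

    upper-swap : ∀ w → upperSum sA sB (swapPoint w) ≈ (upperSum A B w - emptyFirstUpper w) + mu R A B w
    upper-swap w = begin
        upperSum sA sB (swapPoint w)
      ≈⟨ splits3≈Σ₃ (upperTerm R sA sB) (swapPoint w) ⟩
        Σ₃ (upperTerm R sA sB) (swapPoint w)
      ≈⟨ Σ₃-cong swapUpper≈ (swapPoint w) ⟩
        Σ₃ (λ a b c → swapUpper (vs a) (vs b) (vs c)) (swapPoint w)
      ≈⟨ Σ₃-swapPoint swapUpper w ⟩
        Σ₃ (λ a b c → swapUpper (reverse (psumsAfter (a ++ b) c)) (reverse (psumsAfter a b)) (reverse (psums R a))) (us w)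
      ≈⟨ Σ₃-cong (λ a b c → trans (swapUpper-at a b c) (swapUpperAt-split a b c)) (us w) ⟩
        Σ₃ (λ a b c → (upperU a b c - upperEmptyFirst a b c) + muTriple a b c) (us w)
      ≈⟨ Σ₃-lin upperU upperEmptyFirst muTriple (us w) ⟩
        (Σ₃ upperU (us w) - Σ₃ upperEmptyFirst (us w)) + Σ₃ muTriple (us w)
      ≈⟨ +-cong (+-cong (sym upperSum≈) (-‿cong (Σ₃-emptyFirst upperEmptyFirst (λ _ _ _ _ → refl) (us w)))) muSum≈ ⟩
        (upperSum A B w - emptyFirstUpper w) + mu R A B w ∎
      where
      upperSum≈ : upperSum A B w ≈ Σ₃ upperU (us w)
      upperSum≈ = trans (splits3≈Σ₃ (upperTerm R A B) w) (trans (Σ₃-cong upper≈ w) (sym (Σ₃-map upperU proj₁ w)))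
      muSum≈ : Σ₃ muTriple (us w) ≈ mu R A B w
      muSum≈ = trans (Σ₃-emptyLast muTriple (λ _ _ _ _ → refl) (us w))
        (sym (trans (reflexive (mu≡Σ₂ A B w)) (trans (Σ₂-cong mu≈ w) (reflexive (P.sym (Σ₂-map (λ a c → α a * β c) proj₁ w))))))

    lower-swap : ∀ w → lowerSum sA sB (swapPoint w) ≈ lowerSum A B w
    lower-swap w = begin
        lowerSum sA sB (swapPoint w)
      ≈⟨ splits3≈Σ₃ (lowerTerm R sA sB) (swapPoint w) ⟩
        Σ₃ (lowerTerm R sA sB) (swapPoint w)
      ≈⟨ Σ₃-cong swapLower≈ (swapPoint w) ⟩
        Σ₃ (λ a b c → swapLower (vs a) (vs b) (vs c)) (swapPoint w)
      ≈⟨ Σ₃-swapPoint swapLower w ⟩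
        Σ₃ (λ a b c → swapLower (reverse (psumsAfter (a ++ b) c)) (reverse (psumsAfter a b)) (reverse (psums R a))) (us w)
      ≈⟨ Σ₃-cong swapLower-at (us w) ⟩
        Σ₃ (extendFirstTwo lowerCore) (us w)
      ≈⟨ sym (Σ₃-moveCuts lowerCore (us w)) ⟩
        Σ₃ (onNonemptyFirstTwo lowerCore) (us w)
      ≈⟨ Σ₃-map (onNonemptyFirstTwo lowerCore) proj₁ w ⟩
        Σ₃ (λ a b c → onNonemptyFirstTwo lowerCore (us a) (us b) (us c)) w
      ≈⟨ sym (Σ₃-cong lower≈ w) ⟩
        Σ₃ (lowerTerm R A B) w
      ≈⟨ sym (splits3≈Σ₃ (lowerTerm R A B) w) ⟩
        lowerSum A B w ∎

    mu-swap : ∀ w → mu R sA sB (swapPoint w) ≈ emptyFirstUpper w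
    mu-swap w = begin
        mu R sA sB (swapPoint w)
      ≡⟨ mu≡Σ₂ sA sB (swapPoint w) ⟩
        Σ₂ (λ a c → sA a * sB c) (swapPoint w)
      ≈⟨ Σ₂-cong swapMu≈ (swapPoint w) ⟩
        Σ₂ (λ a c → swapMu (vs a) (vs c)) (swapPoint w)
      ≈⟨ Σ₂-swapPoint swapMu w ⟩
        Σ₂ (λ a c → swapMu (reverse (psumsAfter a c)) (reverse (psums R a))) (us w)
      ≈⟨ Σ₂-cong (λ a c → trans (swapMu-at a c) (swapMuAt≈upper a c)) (us w) ⟩
        emptyFirstUpper w ∎

open Proof

lemma2p4p1 : {c ℓ : Level} (R : CommutativeRing c ℓ) (A B : Bimould R) →
    Congruent R A → Congruent R B →
    InARI R A → InARI R B →
    (∀ w → CommutativeRing._≈_ R (push R A w) (A w)) →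
    (∀ w → CommutativeRing._≈_ R (push R B w) (B w)) →
    ∀ w → CommutativeRing._≈_ R (swap R (ari R (swap R A) (swap R B)) w) (ari R A B w)
lemma2p4p1 R A B cA cB iA iB pA pB w =
  trans (+-cong (+-cong (+-cong (AB.upper-swap w) (-‿cong (AB.lower-swap w)))
                        (-‿cong (+-cong (BA.upper-swap w) (-‿cong (BA.lower-swap w)))))
                (+-cong (AB.mu-swap w) (-‿cong (BA.mu-swap w))))
        (rearrange R _ _ _ _ _ _ _ _)
  where
  open CommutativeRing R using (trans; +-cong; -‿cong)
  module AB = Evaluation R A B cA cB iA iB pB
  module BA = Evaluation R B A cB cA iB iA pA
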